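{- For all integers $l_x,l_y,l_z$ with $l_z\ge l_y\ge l_x>3$, the graph $H^{l_x,l_y,l_z}$ does not belong to $\textsc{And}(1)$.
   Context: All graphs are finite, simple and connected. For integers $l_x,l_y,l_z\ge 2$, $H^{l_x,l_y,l_z}$ is the graph consisting of two non-adjacent vertices $a,b$ together with three internally vertex-disjoint paths from $a$ to $b$, namely $X=(a=x_0,x_1,\dots,x_{l_x}=b)$, $Y=(a=y_0,y_1,\dots,y_{l_y}=b)$, $Z=(a=z_0,z_1,\dots,z_{l_z}=b)$, of edge-lengths $l_x,l_y,l_z$ respectively, and no other vertices or edges. An $\textsc{And}(1)$-realization of a graph $G=(V,E)$ is a family $\{([L(v),R(v)],p_v):v\in V\}$ of closed real intervals and points $p_v\in[L(v),R(v)]$ such that for distinct $u,v$: $uv\in E$ iff $p_v\in[L(u),R(u)]$ and $p_u\in[L(v),R(v)]$. $\textsc{And}(1)$ is the class of graphs admitting an $\textsc{And}(1)$-realization. -}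

module Defs where

open import Level using (Level; _⊔_) renaming (suc to lsuc)
open import Data.Nat using (ℕ; zero; suc; _∸_)
open import Data.Fin using (Fin; toℕ)
open import Data.Product using (Σ; _×_)
open import Data.Sum using (_⊎_)
open import Relation.Nullary using (¬_)
open import Relation.Binary.PropositionalEquality using (_≡_)
open import Relation.Binary.Bundles using (TotalOrder)

record Graph : Set₁ where
  field
    V : Set
    E : V → V → Set

data Path : Set where
  X Y Z : Path

len : ℕ → ℕ → ℕ → Path → ℕ
len lx ly lz X = lx
len lx ly lz Y = ly
len lx ly lz Z = lz

-- Vertices: a, b, and the internal vertices of the three paths.
-- `inner P j` is the vertex with index (toℕ j + 1) on path P,
-- i.e. x_1..x_{lx-1}, y_1..y_{ly-1}, z_1..z_{lz-1}.
data HV (lx ly lz : ℕ) : Set where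
  va vb : HV lx ly lz
  inner : (P : Path) → Fin (len lx ly lz P ∸ 1) → HV lx ly lz

data OnPath (lx ly lz : ℕ) : Path → ℕ → HV lx ly lz → Set where
  a-on  : ∀ {P} → OnPath lx ly lz P 0 va
  b-on  : ∀ {P} → OnPath lx ly lz P (len lx ly lz P) vb
  in-on : ∀ {P} (j : Fin (len lx ly lz P ∸ 1)) →
          OnPath lx ly lz P (suc (toℕ j)) (inner P j)

Step : (lx ly lz : ℕ) → HV lx ly lz → HV lx ly lz → Set
Step lx ly lz u v =
  Σ Path λ P → Σ ℕ λ i → OnPath lx ly lz P i u × OnPath lx ly lz P (suc i) v

HE : (lx ly lz : ℕ) → HV lx ly lz → HV lx ly lz → Set
HE lx ly lz u v = Step lx ly lz u v ⊎ Step lx ly lz v u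

H : ℕ → ℕ → ℕ → Graph
H lx ly lz = record { V = HV lx ly lz ; E = HE lx ly lz }

-- And(1)-realizations, over an arbitrary totally ordered carrier
-- (in particular over the reals).

module _ {c ℓ₁ ℓ₂ : Level} (O : TotalOrder c ℓ₁ ℓ₂) where
  open TotalOrder O renaming (Carrier to C)

  InInterval : C → C → C → Set ℓ₂
  InInterval x l r = (l ≤ x) × (x ≤ r)

  record And1Realization (G : Graph) : Set (c ⊔ ℓ₂) where
    open Graph G
    field
      L R p  : V → C
      p∈I    : ∀ v → InInterval (p v) (L v) (R v)
      edge⇒  : ∀ u v → ¬ (u ≡ v) → E u v →
               InInterval (p v) (L u) (R u) × InInterval (p u) (L v) (R v)
      ⇒edge  : ∀ u v → ¬ (u ≡ v) →
               InInterval (p v) (L u) (R u) × InInterval (p u) (L v) (R v) → E u v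

  InAnd1 : Graph → Set (c ⊔ ℓ₂)
  InAnd1 G = And1Realization G

module Submission where

-- Let st be an edge of an And(1)-realized graph and u a vertex distinct from and non-adjacent to s
-- and t with p u between p s and p t. Then the interval of u lies strictly between p s and p t (if it
-- reached p s, u and s would meet), and so do the points of all neighbours of u: lying between the
-- ends of an edge spreads along walks avoiding the closed neighbourhoods of s and t.
-- In H, let w₂ (on the path W) have the median point among x₂, y₂, z₂. Then p w₂ lies
-- between the ends of an edge a u₁ or u₁ u₂ of another path U, and spreading along W to b shows that
-- this edge strictly encloses b, the neighbours of b and (where it may spread further) the vertices two
-- steps from b. By the symmetry a ↔ b of H some edge s′t′ at b likewise encloses the vertices near a.
-- So s′ lies strictly between s and t, s strictly between s′ and t′, and, as the lengths are at least
-- 4, the span of one edge also contains the far end of the other, which no total order admits.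

open import Defs
open import Level using (Level; _⊔_)
open import Data.Nat using (ℕ; zero; suc; pred; _∸_; _<_; _≤_; z≤n; s≤s; _<?_; _≟_)
open import Data.Nat.Properties
  using ( ≤-refl; ≤-trans; m≤n⇒m≤1+n; ≤-pred; <-trans; <-≤-trans; n<1+n; m≤n⇒m<n∨m≡n; m<n⇒m<1+n; ≤∧≢⇒<; ≤-antisym; ≮⇒≥
        ; <⇒≤; <⇒≢; >⇒≢; n≮n; 1+n≢n; 0≢1+n; pred-mono-≤; n∸n≡0; +-∸-assoc; ∸-+-assoc; ∸-monoˡ-≤; ∸-monoʳ-<
        ; suc-injective)
open import Data.Fin using (Fin; toℕ; fromℕ<; opposite)
open import Data.Fin.Properties using (toℕ<n; toℕ-fromℕ<; toℕ-injective; opposite-prop; opposite-involutive)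
open import Data.Product using (∃₂; _×_; _,_; proj₁; proj₂; swap)
open import Data.Sum using (_⊎_; inj₁; inj₂; [_,_]′) renaming (swap to ⊎-swap)
open import Data.Empty using (⊥; ⊥-elim)
open import Relation.Nullary using (¬_; yes; no)
open import Relation.Binary.Bundles using (TotalOrder)
open import Relation.Binary.Definitions using (DecidableEquality)
import Relation.Binary.Properties.TotalOrder as TotalOrderProperties
open import Relation.Binary.PropositionalEquality
  using (_≡_; refl; sym; trans; cong; subst; subst₂; module ≡-Reasoning)

module Betweenness {c ℓ₁ ℓ₂ : Level} (O : TotalOrder c ℓ₁ ℓ₂) where
  open TotalOrder O using (total) renaming (trans to ⊑-trans; Carrier to C; _≤_ to _⊑_; refl to ⊑-refl)
  open TotalOrderProperties O
    using () renaming (_<_ to _⊏_; <-trans to ⊏-trans; <-asym to ⊏-asym; <⇒≱ to ⊏⇒⋣)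

  Between : C → C → C → Set ℓ₂
  Between x y z = (x ⊑ z × z ⊑ y) ⊎ (y ⊑ z × z ⊑ x)

  StrictlyBetween : C → C → C → Set _
  StrictlyBetween x y z = (x ⊏ z × z ⊏ y) ⊎ (y ⊏ z × z ⊏ x)

  Between-sym : ∀ {x y z} → Between x y z → Between y x z
  Between-sym = ⊎-swap

  StrictlyBetween⇒Between : ∀ {x y z} → StrictlyBetween x y z → Between x y z
  StrictlyBetween⇒Between (inj₁ (x⊏z , z⊏y)) = inj₁ (proj₁ x⊏z , proj₁ z⊏y)
  StrictlyBetween⇒Between (inj₂ (y⊏z , z⊏x)) = inj₂ (proj₁ y⊏z , proj₁ z⊏x)

  Between-endʳ : ∀ x y → Between x y y
  Between-endʳ x y with total x y
  ... | inj₁ x⊑y = inj₁ (x⊑y , ⊑-refl)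
  ... | inj₂ y⊑x = inj₂ (⊑-refl , y⊑x)

  Between-split : ∀ {x y z} → Between x y z → ∀ w → Between x w z ⊎ Between w y z
  Between-split {z = z} (inj₁ (x⊑z , z⊑y)) w with total z w
  ... | inj₁ z⊑w = inj₁ (inj₁ (x⊑z , z⊑w))
  ... | inj₂ w⊑z = inj₂ (inj₁ (w⊑z , z⊑y))
  Between-split {z = z} (inj₂ (y⊑z , z⊑x)) w with total z w
  ... | inj₁ z⊑w = inj₂ (inj₂ (y⊑z , z⊑w))
  ... | inj₂ w⊑z = inj₁ (inj₂ (w⊑z , z⊑x))

  median : ∀ x y z → Between y z x ⊎ Between x z y ⊎ Between x y z
  median x y z with total x y | total y z | total x z
  ... | inj₁ x⊑y | inj₁ y⊑z | _        = inj₂ (inj₁ (inj₁ (x⊑y , y⊑z)))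
  ... | inj₁ x⊑y | inj₂ z⊑y | inj₁ x⊑z = inj₂ (inj₂ (inj₁ (x⊑z , z⊑y)))
  ... | inj₁ x⊑y | inj₂ z⊑y | inj₂ z⊑x = inj₁ (inj₂ (z⊑x , x⊑y))
  ... | inj₂ y⊑x | inj₂ z⊑y | _        = inj₂ (inj₁ (inj₂ (z⊑y , y⊑x)))
  ... | inj₂ y⊑x | inj₁ y⊑z | inj₁ x⊑z = inj₁ (inj₁ (y⊑x , x⊑z))
  ... | inj₂ y⊑x | inj₁ y⊑z | inj₂ z⊑x = inj₂ (inj₂ (inj₂ (y⊑z , z⊑x)))

  StrictlyBetween-mutual⇒¬Between : ∀ {x y x′ y′} →
    StrictlyBetween x y x′ → StrictlyBetween x′ y′ x → ¬ Between x y y′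
  StrictlyBetween-mutual⇒¬Between (inj₁ (x⊏x′ , _)) (inj₁ (x′⊏x , _)) _ = ⊏-asym x⊏x′ x′⊏x
  StrictlyBetween-mutual⇒¬Between (inj₁ _) (inj₂ (y′⊏x , _)) (inj₁ (x⊑y′ , _)) = ⊏⇒⋣ y′⊏x x⊑y′
  StrictlyBetween-mutual⇒¬Between (inj₁ (x⊏x′ , x′⊏y)) (inj₂ _) (inj₂ (y⊑y′ , y′⊑x)) =
    ⊏⇒⋣ (⊏-trans x⊏x′ x′⊏y) (⊑-trans y⊑y′ y′⊑x)
  StrictlyBetween-mutual⇒¬Between (inj₂ (_ , x′⊏x)) (inj₂ (_ , x⊏x′)) _ = ⊏-asym x⊏x′ x′⊏x
  StrictlyBetween-mutual⇒¬Between (inj₂ (y⊏x′ , x′⊏x)) (inj₁ _) (inj₁ (x⊑y′ , y′⊑y)) =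
    ⊏⇒⋣ (⊏-trans y⊏x′ x′⊏x) (⊑-trans x⊑y′ y′⊑y)
  StrictlyBetween-mutual⇒¬Between (inj₂ _) (inj₁ (_ , x⊏y′)) (inj₂ (_ , y′⊑x)) = ⊏⇒⋣ x⊏y′ y′⊑x

Apart : (G : Graph) → Graph.V G → Graph.V G → Set
Apart G u v = ¬ u ≡ v × ¬ Graph.E G u v

module Realization {c ℓ₁ ℓ₂ : Level} {O : TotalOrder c ℓ₁ ℓ₂} {G : Graph}
                   (E-irreflexive : ∀ {v} → ¬ Graph.E G v v)
                   (ρ : And1Realization O G) where
  open Graph G
  open And1Realization ρ
  open TotalOrder O using () renaming (trans to ⊑-trans; _≤_ to _⊑_)
  open TotalOrderProperties O using (≰⇒>) renaming (_<_ to _⊏_)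
  open Betweenness O

  Overlap : V → V → Set ℓ₂
  Overlap u v = InInterval O (p v) (L u) (R u) × InInterval O (p u) (L v) (R v)

  edge⇒overlap : ∀ {u v} → E u v → Overlap u v
  edge⇒overlap {u} {v} e = edge⇒ u v (λ { refl → E-irreflexive e }) e

  apart⇒¬overlap : ∀ {u v} → Apart G u v → ¬ Overlap u v
  apart⇒¬overlap {u} {v} (u≢v , ¬e) o = ¬e (⇒edge u v u≢v o)

  -- If x ⊑ p s, then p s ∈ [x , p u] ⊆ I u and p u ∈ [p s , p t] ⊆ I s, so u and s would overlap.
  interval-strictly-within : ∀ {s t u x} → Overlap s t → ¬ Overlap u s → ¬ Overlap u t →
                             p s ⊑ p u → p u ⊑ p t → InInterval O x (L u) (R u) → p s ⊏ x × x ⊏ p t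
  interval-strictly-within {s} {t} {u} ((_ , pt⊑Rs) , (Lt⊑ps , _)) ¬us ¬ut ps⊑pu pu⊑pt (Lu⊑x , x⊑Ru) =
      ≰⇒> (λ x⊑ps → ¬us ( (⊑-trans Lu⊑x x⊑ps , ⊑-trans ps⊑pu (proj₂ (p∈I u)))
                        , (⊑-trans (proj₁ (p∈I s)) ps⊑pu , ⊑-trans pu⊑pt pt⊑Rs)))
    , ≰⇒> (λ pt⊑x → ¬ut ( (⊑-trans (proj₁ (p∈I u)) pu⊑pt , ⊑-trans pt⊑x x⊑Ru)
                        , (⊑-trans Lt⊑ps ps⊑pu , ⊑-trans pu⊑pt (proj₂ (p∈I t)))))

  neighbour-strictly-between : ∀ {s t u v} → E s t → Apart G u s → Apart G u t →
                               Between (p s) (p t) (p u) → E u v → StrictlyBetween (p s) (p t) (p v)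
  neighbour-strictly-between st us ut (inj₁ (ps⊑pu , pu⊑pt)) uv =
    inj₁ (interval-strictly-within (edge⇒overlap st) (apart⇒¬overlap us) (apart⇒¬overlap ut)
                                   ps⊑pu pu⊑pt (proj₁ (edge⇒overlap uv)))
  neighbour-strictly-between st us ut (inj₂ (pt⊑pu , pu⊑ps)) uv =
    inj₂ (interval-strictly-within (swap (edge⇒overlap st)) (apart⇒¬overlap ut) (apart⇒¬overlap us)
                                   pt⊑pu pu⊑ps (proj₁ (edge⇒overlap uv)))

  walk-strictly-between : ∀ {s t m n} → E s t → (f : ℕ → V) →
                          (∀ {i} → m ≤ i → i < n → Apart G (f i) s × Apart G (f i) t × E (f i) (f (suc i))) →
                          m < n → Between (p s) (p t) (p (f m)) → StrictlyBetween (p s) (p t) (p (f n))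
  walk-strictly-between {s} {t} {m} {suc n} st f walk m<1+n start = step (walk m≤n ≤-refl)
    where
      m≤n : m ≤ n
      m≤n = ≤-pred m<1+n

      between-at-n : Between (p s) (p t) (p (f n))
      between-at-n with m≤n⇒m<n∨m≡n m≤n
      ... | inj₁ m<n = StrictlyBetween⇒Between
                         (walk-strictly-between st f (λ m≤i i<n → walk m≤i (m<n⇒m<1+n i<n)) m<n start)
      ... | inj₂ refl = start

      step : Apart G (f n) s × Apart G (f n) t × E (f n) (f (suc n)) →
             StrictlyBetween (p s) (p t) (p (f (suc n)))
      step (fs , ft , e) = neighbour-strictly-between st fs ft between-at-n e

<∸1⇒suc< : ∀ {t n} → t < n ∸ 1 → suc t < n
<∸1⇒suc< {n = suc n} t<n = s≤s t<n

_≟ₚ_ : DecidableEquality Path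
X ≟ₚ X = yes refl
X ≟ₚ Y = no λ ()
X ≟ₚ Z = no λ ()
Y ≟ₚ X = no λ ()
Y ≟ₚ Y = yes refl
Y ≟ₚ Z = no λ ()
Z ≟ₚ X = no λ ()
Z ≟ₚ Y = no λ ()
Z ≟ₚ Z = yes refl

module Structure (lx ly lz : ℕ) where
  Vertex : Set
  Vertex = HV lx ly lz

  ℓ : Path → ℕ
  ℓ = len lx ly lz

  On : Path → ℕ → Vertex → Set
  On = OnPath lx ly lz

  E : Vertex → Vertex → Set
  E = HE lx ly lz

  Apartᴴ : Vertex → Vertex → Set
  Apartᴴ = Apart (H lx ly lz)

  E-sym : ∀ {u v} → E u v → E v u
  E-sym = ⊎-swap

  Apartᴴ-sym : ∀ {u v} → Apartᴴ u v → Apartᴴ v u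
  Apartᴴ-sym (u≢v , ¬uv) = (λ v≡u → u≢v (sym v≡u)) , (λ vu → ¬uv (E-sym vu))

  inner-index-< : ∀ {P} (j : Fin (ℓ P ∸ 1)) → suc (toℕ j) < ℓ P
  inner-index-< j = <∸1⇒suc< (toℕ<n j)

  on-index-≤ : ∀ {P i v} → On P i v → i ≤ ℓ P
  on-index-≤ a-on       = z≤n
  on-index-≤ b-on       = ≤-refl
  on-index-≤ (in-on j)  = <⇒≤ (inner-index-< j)

  on-index-unique : ∀ {P i j v} → On P i v → On P j v → i ≡ j
  on-index-unique a-on      a-on      = refl
  on-index-unique b-on      b-on      = refl
  on-index-unique (in-on _) (in-on _) = refl

  on-vertex-unique : ∀ {P i j u v} → 0 < ℓ P → On P i u → On P j v → i ≡ j → u ≡ v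
  on-vertex-unique _   a-on       a-on       _    = refl
  on-vertex-unique _   b-on       b-on       _    = refl
  on-vertex-unique 0<ℓ a-on       b-on       0≡ℓ  = ⊥-elim (<⇒≢ 0<ℓ 0≡ℓ)
  on-vertex-unique 0<ℓ b-on       a-on       ℓ≡0  = ⊥-elim (>⇒≢ 0<ℓ ℓ≡0)
  on-vertex-unique _   b-on       (in-on j)  ℓ≡j  = ⊥-elim (>⇒≢ (inner-index-< j) ℓ≡j)
  on-vertex-unique _   (in-on j)  b-on       j≡ℓ  = ⊥-elim (<⇒≢ (inner-index-< j) j≡ℓ)
  on-vertex-unique _   (in-on j)  (in-on k)  j≡k  = cong (inner _) (toℕ-injective (suc-injective j≡k))

  inner-path-unique : ∀ {P Q i j w} → On Q j w → 0 < j → j < ℓ Q → On P i w → P ≡ Q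
  inner-path-unique (in-on _) _  _   (in-on _) = refl
  inner-path-unique b-on      _  ℓ<ℓ _         = ⊥-elim (n≮n _ ℓ<ℓ)

  inner-neighbours : ∀ {P j w} → E (inner P j) w → On P (toℕ j) w ⊎ On P (suc (suc (toℕ j))) w
  inner-neighbours (inj₁ (_ , _ , in-on _ , w-next)) = inj₂ w-next
  inner-neighbours (inj₂ (_ , _ , w-prev , in-on _)) = inj₁ w-prev

  neighbours : ∀ {P i u w} → On P i u → 0 < i → i < ℓ P → E u w → On P (pred i) w ⊎ On P (suc i) w
  neighbours (in-on _) _ _   = inner-neighbours
  neighbours b-on      _ ℓ<ℓ = ⊥-elim (n≮n _ ℓ<ℓ)

  E-irreflexive : ∀ {v} → ¬ E v v
  E-irreflexive (inj₁ (_ , _ , v-on , v-on′)) = 1+n≢n (sym (on-index-unique v-on v-on′))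
  E-irreflexive (inj₂ (_ , _ , v-on , v-on′)) = 1+n≢n (sym (on-index-unique v-on v-on′))

  ¬E-a-b : (∀ P → 1 < ℓ P) → ¬ E va vb
  ¬E-a-b ℓ>1 (inj₁ (P , _ , a-on , b-on′)) = <⇒≢ (ℓ>1 P) (on-index-unique b-on′ b-on)
  ¬E-a-b ℓ>1 (inj₂ (_ , _ , _ , ()))

  other-path-apart : ∀ {P Q i j u w} → ¬ P ≡ Q →
                     On P i u → 0 < i → i < ℓ P → On Q j w → 0 < j → j < ℓ Q → Apartᴴ u w
  other-path-apart P≢Q u-on 0<i i<ℓ w-on 0<j j<ℓ =
      (λ { refl → P≢Q (inner-path-unique w-on 0<j j<ℓ u-on) })
    , (λ e → P≢Q ([ inner-path-unique w-on 0<j j<ℓ , inner-path-unique w-on 0<j j<ℓ ]′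
                   (neighbours u-on 0<i i<ℓ e)))

  same-path-non-adjacent : ∀ {P i j u w} → (∀ Q → 1 < ℓ Q) → On P i u → On P j w → suc i < j → ¬ E u w
  same-path-non-adjacent {i = suc i} _ u-on w-on 2+i<j e
    with neighbours u-on (s≤s z≤n) (<-≤-trans (<-trans (n<1+n _) 2+i<j) (on-index-≤ w-on)) e
  ... | inj₁ w-on′ = >⇒≢ (<-trans (n<1+n _) (<-trans (n<1+n _) 2+i<j)) (on-index-unique w-on w-on′)
  ... | inj₂ w-on′ = >⇒≢ 2+i<j (on-index-unique w-on w-on′)
  same-path-non-adjacent {i = zero} ℓ>1 u-on w-on 1<j e
    with m≤n⇒m<n∨m≡n (on-index-≤ w-on)
  ... | inj₂ j≡ℓ = ¬E-a-b ℓ>1 (subst₂ E (on-vertex-unique (<⇒≤ (ℓ>1 _)) u-on a-on refl)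
                                       (on-vertex-unique (<⇒≤ (ℓ>1 _)) w-on b-on j≡ℓ) e)
  ... | inj₁ j<ℓ with neighbours w-on (<-trans (s≤s z≤n) 1<j) j<ℓ (E-sym e)
  ...   | inj₁ u-on′ = <⇒≢ (pred-mono-≤ 1<j) (on-index-unique u-on u-on′)
  ...   | inj₂ u-on′ = 0≢1+n (on-index-unique u-on u-on′)

  same-path-apart : ∀ {P i j u w} → (∀ Q → 1 < ℓ Q) → On P i u → On P j w → suc i < j → Apartᴴ u w
  same-path-apart ℓ>1 u-on w-on i+1<j =
      (λ { refl → <⇒≢ (<-trans (n<1+n _) i+1<j) (on-index-unique u-on w-on) })
    , same-path-non-adjacent ℓ>1 u-on w-on i+1<j

  -- The i-th vertex of P counted from a; junk value vb for i > ℓ P.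
  at : Path → ℕ → Vertex
  at P zero = va
  at P (suc i) with i <? ℓ P ∸ 1
  ... | yes i<ℓ-1 = inner P (fromℕ< i<ℓ-1)
  ... | no  _     = vb

  at-on : ∀ {P i} → i ≤ ℓ P → On P i (at P i)
  at-on {P} {zero}  _     = a-on
  at-on {P} {suc i} i<ℓ with i <? ℓ P ∸ 1
  ... | yes i<ℓ-1 =
    subst (λ n → On P (suc n) (inner P (fromℕ< i<ℓ-1))) (toℕ-fromℕ< i<ℓ-1) (in-on (fromℕ< i<ℓ-1))
  ... | no  i≮ℓ-1 = subst (λ n → On P n vb) (sym (last i<ℓ i≮ℓ-1)) b-on
    where
      last : ∀ {i n} → suc i ≤ n → ¬ i < n ∸ 1 → suc i ≡ n
      last {n = suc n} (s≤s i≤n) i≮n = cong suc (≤-antisym i≤n (≮⇒≥ i≮n))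

  at-edge : ∀ {P i} → i < ℓ P → E (at P i) (at P (suc i))
  at-edge {P} {i} i<ℓ = inj₁ (P , i , at-on (<⇒≤ i<ℓ) , at-on i<ℓ)

  at-end : ∀ P → 0 < ℓ P → at P (ℓ P) ≡ vb
  at-end P 0<ℓ = on-vertex-unique 0<ℓ (at-on ≤-refl) b-on refl

  reflect : Vertex → Vertex
  reflect va          = vb
  reflect vb          = va
  reflect (inner P j) = inner P (opposite j)

  reflect-involutive : ∀ v → reflect (reflect v) ≡ v
  reflect-involutive va          = refl
  reflect-involutive vb          = refl
  reflect-involutive (inner P j) = cong (inner P) (opposite-involutive j)

  reflect-on : ∀ {P i v} → On P i v → On P (ℓ P ∸ i) (reflect v)
  reflect-on a-on          = b-on
  reflect-on {P} b-on      = subst (λ n → On P n va) (sym (n∸n≡0 (ℓ P))) a-on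
  reflect-on {P} (in-on j) = subst (λ n → On P n (inner P (opposite j))) index (in-on (opposite j))
    where
      open ≡-Reasoning
      index : suc (toℕ (opposite j)) ≡ ℓ P ∸ suc (toℕ j)
      index = begin
        suc (toℕ (opposite j))          ≡⟨ cong suc (opposite-prop j) ⟩
        suc ((ℓ P ∸ 1) ∸ suc (toℕ j))   ≡⟨ cong suc (∸-+-assoc (ℓ P) 1 (suc (toℕ j))) ⟩
        suc (ℓ P ∸ suc (suc (toℕ j)))   ≡⟨ sym (+-∸-assoc 1 (inner-index-< {P} j)) ⟩
        ℓ P ∸ suc (toℕ j)               ∎

  reflect-step : ∀ {u v} → Step lx ly lz u v → Step lx ly lz (reflect v) (reflect u)
  reflect-step {u} (P , i , u-on , v-on) =
    P , ℓ P ∸ suc i , reflect-on v-on ,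
    subst (λ n → On P n (reflect u)) (+-∸-assoc 1 (on-index-≤ v-on)) (reflect-on u-on)

  reflect-edge : ∀ {u v} → E u v → E (reflect u) (reflect v)
  reflect-edge (inj₁ uv) = inj₂ (reflect-step uv)
  reflect-edge (inj₂ vu) = inj₁ (reflect-step vu)

  reflect-edge⁻¹ : ∀ {u v} → E (reflect u) (reflect v) → E u v
  reflect-edge⁻¹ {u} {v} e = subst₂ E (reflect-involutive u) (reflect-involutive v) (reflect-edge e)

  reflect-injective : ∀ {u v} → reflect u ≡ reflect v → u ≡ v
  reflect-injective {u} {v} eq =
    trans (sym (reflect-involutive u)) (trans (cong reflect eq) (reflect-involutive v))

  mirror : ∀ {c ℓ₁ ℓ₂} {O : TotalOrder c ℓ₁ ℓ₂} →
           And1Realization O (H lx ly lz) → And1Realization O (H lx ly lz)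
  mirror ρ = record
    { L     = λ v → L (reflect v)
    ; R     = λ v → R (reflect v)
    ; p     = λ v → p (reflect v)
    ; p∈I   = λ v → p∈I (reflect v)
    ; edge⇒ = λ u v u≢v e → edge⇒ (reflect u) (reflect v) (reflect-≢ u≢v) (reflect-edge e)
    ; ⇒edge = λ u v u≢v o → reflect-edge⁻¹ (⇒edge (reflect u) (reflect v) (reflect-≢ u≢v) o)
    }
    where
      open And1Realization ρ
      reflect-≢ : ∀ {u v} → ¬ u ≡ v → ¬ reflect u ≡ reflect v
      reflect-≢ u≢v eq = u≢v (reflect-injective eq)

module Argument {c ℓ₁ ℓ₂ : Level} (O : TotalOrder c ℓ₁ ℓ₂) (lx ly lz : ℕ)
                (ℓ≥4 : ∀ P → 4 ≤ len lx ly lz P) where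
  open Structure lx ly lz
  open TotalOrder O using () renaming (Carrier to C)
  open Betweenness O

  ≤3⇒<ℓ : ∀ P {i} → i ≤ 3 → i < ℓ P
  ≤3⇒<ℓ P i≤3 = ≤-trans (s≤s i≤3) (ℓ≥4 P)

  ℓ>1 : ∀ P → 1 < ℓ P
  ℓ>1 P = ≤3⇒<ℓ P (s≤s z≤n)

  at-on-near-a : ∀ P {i} → i ≤ 3 → On P i (at P i)
  at-on-near-a P i≤3 = at-on (<⇒≤ (≤3⇒<ℓ P i≤3))

  inner-apart-near-a : ∀ {U W i j} → ¬ U ≡ W → i ≤ 2 → 2 ≤ j → j < ℓ W → Apartᴴ (at W j) (at U i)
  inner-apart-near-a {i = zero} _ _ 2≤j j<ℓ = Apartᴴ-sym (same-path-apart ℓ>1 a-on (at-on (<⇒≤ j<ℓ)) 2≤j)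
  inner-apart-near-a {U} {i = suc i} U≢W i+1≤2 2≤j j<ℓ =
    other-path-apart (λ W≡U → U≢W (sym W≡U)) (at-on (<⇒≤ j<ℓ)) (<-trans (s≤s z≤n) 2≤j) j<ℓ
                     (at-on-near-a U (m≤n⇒m≤1+n i+1≤2)) (s≤s z≤n) (≤3⇒<ℓ U (m≤n⇒m≤1+n i+1≤2))

  b-apart-near-a : ∀ {U i} → i ≤ 2 → Apartᴴ vb (at U i)
  b-apart-near-a {U} i≤2 =
    Apartᴴ-sym (same-path-apart ℓ>1 (at-on-near-a U (m≤n⇒m≤1+n i≤2)) b-on (≤3⇒<ℓ U (s≤s i≤2)))

  -- reflect (at V i) is the i-th vertex of V counted from b.
  record EnclosesNearB (p : Vertex → C) (s t : Vertex) : Set (ℓ₁ ⊔ ℓ₂) where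
    field
      near-b       : ∀ V {i} → i ≤ 1 → StrictlyBetween (p s) (p t) (p (reflect (at V i)))
      third-from-b : ∀ V → Apartᴴ (reflect (at V 1)) s → Apartᴴ (reflect (at V 1)) t →
                     StrictlyBetween (p s) (p t) (p (reflect (at V 2)))
  open EnclosesNearB

  EdgeAtAEnclosesNearB : (Vertex → C) → Set (ℓ₁ ⊔ ℓ₂)
  EdgeAtAEnclosesNearB p = ∃₂ λ U k → k ≤ 1 × EnclosesNearB p (at U k) (at U (suc k))

  module Realized (ρ : And1Realization O (H lx ly lz)) where
    open And1Realization ρ
    open Realization E-irreflexive ρ

    encloses-from-other-path : ∀ {U W k} → ¬ U ≡ W → k ≤ 1 →
                               Between (p (at U k)) (p (at U (suc k))) (p (at W 2)) →
                               EnclosesNearB p (at U k) (at U (suc k))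
    encloses-from-other-path {U} {W} {k} U≢W k≤1 at-W-2-between = record
      { near-b       = λ { V z≤n → b-between ; V (s≤s z≤n) → b-neighbour-between V }
      ; third-from-b = λ V s-apart t-apart →
          neighbour-strictly-between st s-apart t-apart
            (StrictlyBetween⇒Between (b-neighbour-between V)) (reflect-edge (at-edge (≤3⇒<ℓ V (s≤s z≤n))))
      }
      where
        st : E (at U k) (at U (suc k))
        st = at-edge (≤3⇒<ℓ U (≤-trans k≤1 (s≤s z≤n)))

        climb : ∀ {j} → 2 ≤ j → j < ℓ W →
                Apartᴴ (at W j) (at U k) × Apartᴴ (at W j) (at U (suc k)) × E (at W j) (at W (suc j))
        climb 2≤j j<ℓ = inner-apart-near-a U≢W (m≤n⇒m≤1+n k≤1) 2≤j j<ℓ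
                      , inner-apart-near-a U≢W (s≤s k≤1) 2≤j j<ℓ
                      , at-edge j<ℓ

        b-between : StrictlyBetween (p (at U k)) (p (at U (suc k))) (p vb)
        b-between = subst (λ v → StrictlyBetween _ _ (p v)) (at-end W (<-trans (s≤s z≤n) (ℓ>1 W)))
                          (walk-strictly-between st (at W) climb (≤3⇒<ℓ W (s≤s (s≤s z≤n))) at-W-2-between)

        b-neighbour-between : ∀ V → StrictlyBetween (p (at U k)) (p (at U (suc k))) (p (reflect (at V 1)))
        b-neighbour-between V =
          neighbour-strictly-between st (b-apart-near-a (m≤n⇒m≤1+n k≤1)) (b-apart-near-a (s≤s k≤1))
            (StrictlyBetween⇒Between b-between) (reflect-edge (at-edge (≤3⇒<ℓ V z≤n)))

    -- at W 2 lies between the ends of some edge of the walk at U 2, at U 1, a, at V 1, at V 2.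
    encloses-from-median : ∀ {U V W} → ¬ U ≡ W → ¬ V ≡ W →
                           Between (p (at U 2)) (p (at V 2)) (p (at W 2)) → EdgeAtAEnclosesNearB p
    encloses-from-median {U} {V} U≢W V≢W between with Between-split between (p (at U 1))
    ... | inj₁ b = U , 1 , s≤s z≤n , encloses-from-other-path U≢W (s≤s z≤n) (Between-sym b)
    ... | inj₂ b with Between-split b (p va)
    ...   | inj₁ b′ = U , 0 , z≤n , encloses-from-other-path U≢W z≤n (Between-sym b′)
    ...   | inj₂ b′ with Between-split b′ (p (at V 1))
    ...     | inj₁ b″ = V , 0 , z≤n , encloses-from-other-path V≢W z≤n b″
    ...     | inj₂ b″ = V , 1 , s≤s z≤n , encloses-from-other-path V≢W (s≤s z≤n) b″

    edge-at-a-encloses-near-b : EdgeAtAEnclosesNearB p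
    edge-at-a-encloses-near-b with median (p (at X 2)) (p (at Y 2)) (p (at Z 2))
    ... | inj₁ b        = encloses-from-median {Y} {Z} {X} (λ ()) (λ ()) b
    ... | inj₂ (inj₁ b) = encloses-from-median {X} {Z} {Y} (λ ()) (λ ()) b
    ... | inj₂ (inj₂ b) = encloses-from-median {X} {Y} {Z} (λ ()) (λ ()) b

    near-a : ∀ {s t} → EnclosesNearB (λ v → p (reflect v)) s t →
             ∀ U {i} → i ≤ 1 → StrictlyBetween (p (reflect s)) (p (reflect t)) (p (at U i))
    near-a {s} {t} enc U {i} i≤1 =
      subst (λ v → StrictlyBetween (p (reflect s)) (p (reflect t)) (p v)) (reflect-involutive (at U i))
            (near-b enc U i≤1)

    penultimate-apart-other-path : ∀ {U V i} → ¬ U ≡ V → 0 < i → i < ℓ U → Apartᴴ (reflect (at V 1)) (at U i)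
    penultimate-apart-other-path {U} {V} U≢V 0<i i<ℓ =
      other-path-apart (λ V≡U → U≢V (sym V≡U)) (reflect-on (at-on (<⇒≤ (ℓ>1 V))))
        (∸-monoˡ-≤ 1 (ℓ>1 V)) (∸-monoʳ-< (s≤s z≤n) (<⇒≤ (ℓ>1 V))) (at-on (<⇒≤ i<ℓ)) 0<i i<ℓ

    penultimate-apart-same-path : ∀ {U i} → ¬ ℓ U ≡ 4 → i ≤ 2 → Apartᴴ (reflect (at U 1)) (at U i)
    penultimate-apart-same-path {U} ℓ≢4 i≤2 =
      Apartᴴ-sym (same-path-apart ℓ>1 (at-on-near-a U (m≤n⇒m≤1+n i≤2))
                   (reflect-on (at-on (<⇒≤ (ℓ>1 U))))
                   (≤-trans (s≤s (s≤s i≤2)) (∸-monoˡ-≤ 1 (≤∧≢⇒< (ℓ≥4 U) (λ 4≡ℓ → ℓ≢4 (sym 4≡ℓ))))))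

    far-end-between-second-edges : ∀ {U V} → EnclosesNearB p (at U 1) (at U 2) →
                                   Between (p (at U 1)) (p (at U 2)) (p (reflect (at V 2)))
    far-end-between-second-edges {U} {V} enc with U ≟ₚ V
    ... | no U≢V = StrictlyBetween⇒Between (third-from-b enc V
                     (penultimate-apart-other-path U≢V (s≤s z≤n) (≤3⇒<ℓ U (s≤s z≤n)))
                     (penultimate-apart-other-path U≢V (s≤s z≤n) (≤3⇒<ℓ U (s≤s (s≤s z≤n)))))
    ... | yes refl with ℓ U ≟ 4
    ...   | no ℓ≢4 = StrictlyBetween⇒Between (third-from-b enc U
                       (penultimate-apart-same-path ℓ≢4 (s≤s z≤n))
                       (penultimate-apart-same-path ℓ≢4 (s≤s (s≤s z≤n))))
    ...   | yes ℓ≡4 = subst (λ v → Between (p (at U 1)) (p (at U 2)) (p v)) (sym shared) (Between-endʳ _ _)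
      where
        shared : reflect (at U 2) ≡ at U 2
        shared = on-vertex-unique (<⇒≤ (ℓ>1 U)) (reflect-on (at-on (ℓ>1 U))) (at-on (ℓ>1 U))
                                  (cong (_∸ 2) ℓ≡4)

    far-end-between : ∀ {U V k k′} → k ≤ 1 → k′ ≤ 1 →
                      EnclosesNearB p (at U k) (at U (suc k)) →
                      EnclosesNearB (λ v → p (reflect v)) (at V k′) (at V (suc k′)) →
                      Between (p (at U k)) (p (at U (suc k))) (p (reflect (at V (suc k′))))
                      ⊎ Between (p (reflect (at V k′))) (p (reflect (at V (suc k′)))) (p (at U (suc k)))
    far-end-between {U} z≤n _ _ enc′ = inj₂ (StrictlyBetween⇒Between (near-a enc′ U (s≤s z≤n)))
    far-end-between {V = V} (s≤s z≤n) z≤n enc _ = inj₁ (StrictlyBetween⇒Between (near-b enc V (s≤s z≤n)))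
    far-end-between (s≤s z≤n) (s≤s z≤n) enc _ = inj₁ (far-end-between-second-edges enc)

    edges-at-both-ends-cannot-enclose : EdgeAtAEnclosesNearB p → EdgeAtAEnclosesNearB (λ v → p (reflect v)) → ⊥
    edges-at-both-ends-cannot-enclose (U , k , k≤1 , enc) (V , k′ , k′≤1 , enc′) =
      [ StrictlyBetween-mutual⇒¬Between (near-b enc V k′≤1) (near-a enc′ U k≤1)
      , StrictlyBetween-mutual⇒¬Between (near-a enc′ U k≤1) (near-b enc V k′≤1)
      ]′ (far-end-between k≤1 k′≤1 enc enc′)

  no-realization : ¬ And1Realization O (H lx ly lz)
  no-realization ρ =
    edges-at-both-ends-cannot-enclose edge-at-a-encloses-near-b (Realized.edge-at-a-encloses-near-b (mirror ρ))
    where open Realized ρ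

lemma4 : {c ℓ₁ ℓ₂ : Level} (O : TotalOrder c ℓ₁ ℓ₂) (lx ly lz : ℕ) →
    3 < lx → lx ≤ ly → ly ≤ lz → ¬ InAnd1 O (H lx ly lz)
lemma4 O lx ly lz 3<lx lx≤ly ly≤lz = Argument.no-realization O lx ly lz ℓ≥4
  where
    ℓ≥4 : ∀ P → 4 ≤ len lx ly lz P
    ℓ≥4 X = 3<lx
    ℓ≥4 Y = ≤-trans 3<lx lx≤ly
    ℓ≥4 Z = ≤-trans (≤-trans 3<lx lx≤ly) ly≤lz
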